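{- Let $T$ be a tree on $n$ vertices. If $T$ has a perfect matching, then $\gamma_{WC}(T)=s_{WC}(T)=n/2$. In all other cases, Dominator does not win the $(1:1)$ Waiter-Client domination game on $T$.
   Context: The (unbiased) Waiter-Client domination game on a graph $G$: in each round Dominator (Waiter) offers two unclaimed vertices of $G$, Staller (Client) picks one of them for himself and the other goes to Dominator; if in the last round only one unclaimed vertex remains, it goes to Staller. Dominator wins if she claims all vertices of some dominating set of $G$. $\gamma_{WC}(G)$ is the smallest number of rounds within which Dominator can always occupy a dominating set, and $s_{WC}(G)$ is the smallest size of a dominating set Dominator can always claim (both $\infty$ if Dominator has no winning strategy). -}

module Defs where

open import Data.Nat using (ℕ; zero; suc; _≤_; _<_)
open import Data.Fin using (Fin)
open import Data.Fin.Subset using (Subset; _∈_; _∉_; _⊆_; _∪_; ⁅_⁆; ∣_∣) renaming (⊥ to ∅)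
open import Data.List using (List; _∷_; []; _∷ʳ_; length)
open import Data.List.Relation.Unary.Linked using (Linked)
open import Data.List.Relation.Unary.Unique.Propositional using (Unique)
open import Data.Product using (Σ; _×_; ∃)
open import Data.Sum using (_⊎_)
open import Data.Empty using (⊥)
open import Relation.Nullary using (¬_)
open import Relation.Binary.PropositionalEquality using (_≡_; _≢_)

record Graph (n : ℕ) : Set₁ where
  field
    Adj     : Fin n → Fin n → Set
    symAdj  : ∀ {u v} → Adj u v → Adj v u
    irrefl  : ∀ {v} → ¬ Adj v v
open Graph public

module _ {n : ℕ} (G : Graph n) where

  data Walk : Fin n → Fin n → Set where
    here : ∀ {v} → Walk v v
    step : ∀ {u w v} → Adj G u w → Walk w v → Walk u v

  Connected : Set
  Connected = ∀ u v → Walk u v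

  -- a cycle: distinct vertices x, x₁, …, x_k (k ≥ 2), consecutive ones adjacent,
  -- and x_k adjacent to x
  HasCycle : Set
  HasCycle = Σ (Fin n) λ x → Σ (List (Fin n)) λ xs →
    (2 ≤ length xs) × Unique (x ∷ xs) × Linked (Adj G) ((x ∷ xs) ∷ʳ x)

  IsTree : Set
  IsTree = Connected × ¬ HasCycle

  -- a perfect matching, given by its partner function: every vertex v is
  -- matched by an edge {v , m v}, and the edges are pairwise disjoint
  HasPerfectMatching : Set
  HasPerfectMatching = Σ (Fin n → Fin n) λ m →
    (∀ v → Adj G v (m v)) × (∀ v → m (m v) ≡ v)

  Dominating : Subset n → Set
  Dominating X = ∀ v → v ∈ X ⊎ Σ (Fin n) λ u → u ∈ X × Adj G v u

  ContainsDomSetOfSize≤ : ℕ → Subset n → Set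
  ContainsDomSetOfSize≤ s D = Σ (Subset n) λ X → X ⊆ D × Dominating X × ∣ X ∣ ≤ s

  ContainsDomSet : Subset n → Set
  ContainsDomSet D = Σ (Subset n) λ X → X ⊆ D × Dominating X

  Unclaimed : Subset n → Subset n → Fin n → Set
  Unclaimed D S v = v ∉ D × v ∉ S

  -- Waiter-Client game from position (D = Dominator's vertices, S = Staller's):
  -- ForcesIn P k D S  means Dominator can guarantee that her set satisfies P
  -- within at most k further rounds.  In a round Dominator offers two distinct
  -- unclaimed vertices u, v; Staller takes one, Dominator gets the other.
  -- (A single leftover vertex goes to Staller and never helps Dominator.)
  data ForcesIn (P : Subset n → Set) : ℕ → Subset n → Subset n → Set where
    done : ∀ {k D S} → P D → ForcesIn P k D S
    move : ∀ {k D S} (u v : Fin n) → u ≢ v →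
           Unclaimed D S u → Unclaimed D S v →
           ForcesIn P k (D ∪ ⁅ v ⁆) (S ∪ ⁅ u ⁆) →
           ForcesIn P k (D ∪ ⁅ u ⁆) (S ∪ ⁅ v ⁆) →
           ForcesIn P (suc k) D S

  data Forces (P : Subset n → Set) : Subset n → Subset n → Set where
    done : ∀ {D S} → P D → Forces P D S
    move : ∀ {D S} (u v : Fin n) → u ≢ v →
           Unclaimed D S u → Unclaimed D S v →
           Forces P (D ∪ ⁅ v ⁆) (S ∪ ⁅ u ⁆) →
           Forces P (D ∪ ⁅ u ⁆) (S ∪ ⁅ v ⁆) →
           Forces P D S

  DominatorWins : Set
  DominatorWins = Forces ContainsDomSet ∅ ∅

  γWC≡ : ℕ → Set
  γWC≡ k = ForcesIn ContainsDomSet k ∅ ∅ ×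
           (∀ j → j < k → ¬ ForcesIn ContainsDomSet j ∅ ∅)

  sWC≡ : ℕ → Set
  sWC≡ s = Forces (ContainsDomSetOfSize≤ s) ∅ ∅ ×
           (∀ j → j < s → ¬ Forces (ContainsDomSetOfSize≤ j) ∅ ∅)

{-# OPTIONS --safe #-}
module Submission where

-- With a perfect matching, Dominator offers an unclaimed vertex together
-- with its partner; every vertex Staller takes then has its partner in
-- Dominator's set, so after n/2 rounds her set dominates.
--
-- Conversely, a forest can be stripped by repeatedly removing a leaf v
-- together with its neighbour u, until either nothing is left (the pairs
-- then form a perfect matching) or a vertex w remains whose neighbours were
-- all removed as supports u.  Staller answers an offer inside the earliest
-- stripped pair it touches: offered the whole pair he takes u, offered one
-- of its vertices he takes that one.  While all pairs are intact Dominator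
-- owns no support, so her dominating set must contain every leaf v (n/2
-- vertices when everything was stripped) and cannot dominate w.  Once a pair
-- is broken into, Staller never lets Dominator have a vertex of the first
-- broken pair, whose leaf therefore stays undominated.

open import Defs
open import Algebra.Bundles using (CommutativeMonoid)
open import Data.Empty using (⊥; ⊥-elim)
open import Data.Unit using (⊤)
open import Data.Fin using (Fin; zero; suc; _≟_)
open import Data.Fin.Properties using (all?; ¬∀⟶∃¬; injective⇒≤)
open import Data.Fin.Subset using (Subset; inside; outside; _∈_; _∉_; _⊆_; _∪_; _-_; ⁅_⁆; ∣_∣) renaming (⊥ to ∅)
open import Data.Fin.Subset.Properties
  using ( _∈?_; ∉⊥; ∈⊤; x∈⁅x⁆; x∈⁅y⁆⇒x≡y; x∈p∪q⁻; p⊆p∪q; q⊆p∪q; ∪-identityʳ; ∪-commutativeMonoid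
        ; ∣p∣≤n; ∣⊤∣≡n; ∣⊥∣≡0; p⊆q⇒∣p∣≤∣q∣; p⊂q⇒∣p∣<∣q∣; x∈p⇒∣p-x∣<∣p∣; x∈p∧x≢y⇒x∈p-y )
open import Data.Vec using (_∷_)
open import Data.List using (List; []; _∷_; _++_; [_]; length; lookup; allFin)
open import Data.List.Properties using (length-++)
open import Data.List.Relation.Unary.All as All using (All; []; _∷_)
open import Data.List.Relation.Unary.All.Properties using (¬Any⇒All¬; ++⁺; ++⁻ˡ; ++⁻ʳ)
open import Data.List.Relation.Unary.Any using (here; there)
open import Data.List.Relation.Unary.Any.Properties using (lookup-index)
open import Data.List.Relation.Unary.Linked using (Linked; []; [-]; _∷_)
open import Data.List.Relation.Unary.Unique.Propositional using (Unique; []; _∷_)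
open import Data.List.Membership.Propositional using () renaming (_∈_ to _∈ₗ_; _∉_ to _∉ₗ_)
open import Data.List.Membership.Propositional.Properties using (∈-allFin; ∈-∃++)
open import Data.Nat using (ℕ; zero; suc; _≤_; _<_; _+_; _*_; _/_; _%_; z≤n; s≤s; s≤s⁻¹)
open import Data.Nat.DivMod using (m≡m%n+[m/n]*n; m%n<n; /-monoˡ-≤; m*n/n≡m)
open import Data.Nat.Properties
  using ( module ≤-Reasoning; ≤-refl; ≤-trans; ≤-reflexive; <-irrefl; <⇒≱; n≤1+n; m≤m+n; m≤n+m
        ; +-identityʳ; +-suc; +-monoˡ-≤; +-monoʳ-≤ )
open import Data.Product using (Σ; _×_; _,_; proj₁; proj₂)
open import Data.Sum using (_⊎_; inj₁; inj₂; [_,_]′)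
import Data.Sum as Sum
import Data.Product as Product
open import Function using (_∘_; id)
open import Relation.Nullary using (¬_; yes; no; Dec)
open import Relation.Nullary.Decidable using (decidable-stable; ¬¬-excluded-middle)
open import Relation.Binary.PropositionalEquality using (_≡_; _≢_; refl; sym; trans; cong; subst)

m+[2+n]≡2+[m+n] : ∀ m n → m + suc (suc n) ≡ suc (suc (m + n))
m+[2+n]≡2+[m+n] m n = trans (+-suc m (suc n)) (cong suc (+-suc m n))

n≤m*2⇒n/2≤m : ∀ {n m} → n ≤ m * 2 → n / 2 ≤ m
n≤m*2⇒n/2≤m {m = m} n≤m*2 = ≤-trans (/-monoˡ-≤ 2 n≤m*2) (≤-reflexive (m*n/n≡m m 2))

x∈p∪⁅y⁆⁻ : ∀ {n} {x y : Fin n} (p : Subset n) → x ∈ p ∪ ⁅ y ⁆ → x ∈ p ⊎ x ≡ y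
x∈p∪⁅y⁆⁻ {y = y} p x∈ = Sum.map₂ (x∈⁅y⁆⇒x≡y y) (x∈p∪q⁻ p ⁅ y ⁆ x∈)

x∈p∪⁅x⁆ : ∀ {n} (p : Subset n) x → x ∈ p ∪ ⁅ x ⁆
x∈p∪⁅x⁆ p x = q⊆p∪q p ⁅ x ⁆ (x∈⁅x⁆ x)

x∉p∪⁅y⁆ : ∀ {n} {p : Subset n} {x y} → x ∉ p → y ≢ x → x ∉ p ∪ ⁅ y ⁆
x∉p∪⁅y⁆ {p = p} x∉p y≢x x∈ = [ x∉p , y≢x ∘ sym ]′ (x∈p∪⁅y⁆⁻ p x∈)

∣p∪⁅x⁆∣≤1+∣p∣ : ∀ {n} (p : Subset n) x → ∣ p ∪ ⁅ x ⁆ ∣ ≤ suc ∣ p ∣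
∣p∪⁅x⁆∣≤1+∣p∣ (inside  ∷ p) zero    rewrite ∪-identityʳ p = n≤1+n _
∣p∪⁅x⁆∣≤1+∣p∣ (outside ∷ p) zero    rewrite ∪-identityʳ p = ≤-refl
∣p∪⁅x⁆∣≤1+∣p∣ (inside  ∷ p) (suc x) = s≤s (∣p∪⁅x⁆∣≤1+∣p∣ p x)
∣p∪⁅x⁆∣≤1+∣p∣ (outside ∷ p) (suc x) = ∣p∪⁅x⁆∣≤1+∣p∣ p x

x∉p⇒∣p∣<∣p∪⁅x⁆∣ : ∀ {n} {p : Subset n} {x} → x ∉ p → ∣ p ∣ < ∣ p ∪ ⁅ x ⁆ ∣
x∉p⇒∣p∣<∣p∪⁅x⁆∣ {p = p} {x} x∉p = p⊂q⇒∣p∣<∣q∣ (p⊆p∪q ⁅ x ⁆ , x , x∈p∪⁅x⁆ p x , x∉p)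

two-new⇒2+∣D∪S∣≤ : ∀ {n} {D S : Subset n} {s t} → s ∉ D ∪ S → t ∉ D ∪ S → t ≢ s →
                   2 + ∣ D ∪ S ∣ ≤ ∣ (D ∪ ⁅ t ⁆) ∪ (S ∪ ⁅ s ⁆) ∣
two-new⇒2+∣D∪S∣≤ {n} {D} {S} {s} {t} s∉D∪S t∉D∪S t≢s = begin
  2 + ∣ D ∪ S ∣                  ≤⟨ s≤s (x∉p⇒∣p∣<∣p∪⁅x⁆∣ t∉D∪S) ⟩
  suc ∣ (D ∪ S) ∪ ⁅ t ⁆ ∣        ≤⟨ x∉p⇒∣p∣<∣p∪⁅x⁆∣ (x∉p∪⁅y⁆ s∉D∪S t≢s) ⟩
  ∣ ((D ∪ S) ∪ ⁅ t ⁆) ∪ ⁅ s ⁆ ∣  ≡⟨ cong ∣_∣ rearrange ⟩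
  ∣ (D ∪ ⁅ t ⁆) ∪ (S ∪ ⁅ s ⁆) ∣  ∎
  where
  open ≤-Reasoning
  open CommutativeMonoid (∪-commutativeMonoid n) using (assoc; commutativeSemigroup)
  open import Algebra.Properties.CommutativeSemigroup commutativeSemigroup using (interchange)
  rearrange : ((D ∪ S) ∪ ⁅ t ⁆) ∪ ⁅ s ⁆ ≡ (D ∪ ⁅ t ⁆) ∪ (S ∪ ⁅ s ⁆)
  rearrange = trans (assoc (D ∪ S) ⁅ t ⁆ ⁅ s ⁆) (sym (interchange D ⁅ t ⁆ S ⁅ s ⁆))

Unique⇒length≤∣p∣ : ∀ {n} {xs : List (Fin n)} {p : Subset n} → Unique xs → All (_∈ p) xs → length xs ≤ ∣ p ∣
Unique⇒length≤∣p∣ []                [] = z≤n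
Unique⇒length≤∣p∣ {xs = x ∷ xs} {p} (x≢xs ∷ unique) (x∈p ∷ xs⊆p) =
  ≤-trans (s≤s (Unique⇒length≤∣p∣ unique xs⊆p-x)) (x∈p⇒∣p-x∣<∣p∣ x∈p)
  where
  xs⊆p-x : All (_∈ p - x) xs
  xs⊆p-x = All.zipWith (λ (x≢y , y∈p) → x∈p∧x≢y⇒x∈p-y y∈p (x≢y ∘ sym)) (x≢xs , xs⊆p)

Unique⇒length≤n : ∀ {n} {xs : List (Fin n)} → Unique xs → length xs ≤ n
Unique⇒length≤n {n} {xs} unique =
  subst (length xs ≤_) (∣⊤∣≡n n) (Unique⇒length≤∣p∣ unique (All.universal (λ _ → ∈⊤) xs))

complete⇒n≤length : ∀ {n} {xs : List (Fin n)} → (∀ x → x ∈ₗ xs) → n ≤ length xs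
complete⇒n≤length {xs = xs} complete = injective⇒≤ λ {x} {y} index-x≡index-y →
  trans (lookup-index (complete x)) (trans (cong (lookup xs) index-x≡index-y) (sym (lookup-index (complete y))))

Unique-prefix : ∀ {A : Set} (xs : List A) {z ys} → Unique (xs ++ z ∷ ys) → Unique (xs ++ [ z ])
Unique-prefix []       _                 = [] ∷ []
Unique-prefix (x ∷ xs) (x∉rest ∷ unique) =
  ++⁺ (++⁻ˡ xs x∉rest) (All.head (++⁻ʳ xs x∉rest) ∷ []) ∷ Unique-prefix xs unique

Linked-prefix-∷ʳ : ∀ {A : Set} {R : A → A → Set} (xs : List A) {z ys b} →
                   Linked R (xs ++ z ∷ ys) → R z b → Linked R ((xs ++ [ z ]) ++ [ b ])
Linked-prefix-∷ʳ []           _              zRb = zRb ∷ [-]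
Linked-prefix-∷ʳ (x ∷ [])     (xRz ∷ _)      zRb = xRz ∷ zRb ∷ [-]
Linked-prefix-∷ʳ (x ∷ y ∷ xs) (xRy ∷ linked) zRb = xRy ∷ Linked-prefix-∷ʳ (y ∷ xs) linked zRb

module _ {n : ℕ} (G : Graph n) where

  ForcesIn⇒Forces-size≤ : ∀ {k j D S} → ForcesIn G (ContainsDomSet G) k D S → ∣ D ∣ + k ≤ j →
                          Forces G (ContainsDomSetOfSize≤ G j) D S
  ForcesIn⇒Forces-size≤ {k} (done (X , X⊆D , dominating)) bound =
    done (X , X⊆D , dominating , ≤-trans (p⊆q⇒∣p∣≤∣q∣ X⊆D) (≤-trans (m≤m+n _ k) bound))
  ForcesIn⇒Forces-size≤ {suc k} {j} {D} (move u v u≢v u-free v-free forces₁ forces₂) bound =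
    move u v u≢v u-free v-free (ForcesIn⇒Forces-size≤ forces₁ (claim v)) (ForcesIn⇒Forces-size≤ forces₂ (claim u))
    where
    claim : ∀ x → ∣ D ∪ ⁅ x ⁆ ∣ + k ≤ j
    claim x = ≤-trans (+-monoˡ-≤ k (∣p∪⁅x⁆∣≤1+∣p∣ D x)) (≤-trans (≤-reflexive (sym (+-suc ∣ D ∣ k))) bound)

  ForcesIn-∅⇒Forces-size≤ : ∀ {k} → ForcesIn G (ContainsDomSet G) k ∅ ∅ → Forces G (ContainsDomSetOfSize≤ G k) ∅ ∅
  ForcesIn-∅⇒Forces-size≤ {k} forces = ForcesIn⇒Forces-size≤ forces (≤-reflexive (cong (_+ k) (∣⊥∣≡0 n)))

  StallerMaintains : (Subset n → Subset n → Set) → Set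
  StallerMaintains Inv = ∀ {D S} u v → u ≢ v → Unclaimed G D S u → Unclaimed G D S v → Inv D S →
                         Inv (D ∪ ⁅ v ⁆) (S ∪ ⁅ u ⁆) ⊎ Inv (D ∪ ⁅ u ⁆) (S ∪ ⁅ v ⁆)

  maintained⇒¬Forces : ∀ {Inv P} → StallerMaintains Inv → (∀ {D S} → Inv D S → ¬ P D) →
                       ∀ {D S} → Inv D S → ¬ Forces G P D S
  maintained⇒¬Forces maintain excludes inv (done p) = excludes inv p
  maintained⇒¬Forces maintain excludes inv (move u v u≢v u-free v-free forces₁ forces₂) =
    [ (λ inv₁ → maintained⇒¬Forces maintain excludes inv₁ forces₁)
    , (λ inv₂ → maintained⇒¬Forces maintain excludes inv₂ forces₂)
    ]′ (maintain u v u≢v u-free v-free inv)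

-- Dominator's pairing strategy

module PairingStrategy {n : ℕ} (G : Graph n) (m : Fin n → Fin n)
                       (m-adj : ∀ v → Adj G v (m v)) (m-inv : ∀ v → m (m v) ≡ v) where

  Claimed : Subset n → Subset n → Fin n → Set
  Claimed D S w = w ∈ D ⊎ w ∈ S

  Claimed-mono : ∀ {D S a b w} → Claimed D S w → Claimed (D ∪ ⁅ a ⁆) (S ∪ ⁅ b ⁆) w
  Claimed-mono {a = a} {b} = Sum.map (p⊆p∪q ⁅ a ⁆) (p⊆p∪q ⁅ b ⁆)

  record Paired (D S : Subset n) : Set where
    field
      partner-of-staller : ∀ {w} → w ∈ S → m w ∈ D
      closed             : ∀ {w} → Claimed D S w → Claimed D S (m w)
  open Paired

  Paired-∅ : Paired ∅ ∅
  Paired-∅ = record { partner-of-staller = ⊥-elim ∘ ∉⊥ ; closed = [ ⊥-elim ∘ ∉⊥ , ⊥-elim ∘ ∉⊥ ]′ }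

  Paired-step : ∀ {D S} s → Paired D S → Paired (D ∪ ⁅ m s ⁆) (S ∪ ⁅ s ⁆)
  Paired-step {D} {S} s paired = record { partner-of-staller = partner-of-staller′ ; closed = closed′ }
    where
    partner-of-staller′ : ∀ {w} → w ∈ S ∪ ⁅ s ⁆ → m w ∈ D ∪ ⁅ m s ⁆
    partner-of-staller′ w∈ with x∈p∪⁅y⁆⁻ S w∈
    ... | inj₁ w∈S  = p⊆p∪q ⁅ m s ⁆ (partner-of-staller paired w∈S)
    ... | inj₂ refl = x∈p∪⁅x⁆ D (m s)
    closed′ : ∀ {w} → Claimed (D ∪ ⁅ m s ⁆) (S ∪ ⁅ s ⁆) w → Claimed (D ∪ ⁅ m s ⁆) (S ∪ ⁅ s ⁆) (m w)
    closed′ (inj₁ w∈) with x∈p∪⁅y⁆⁻ D w∈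
    ... | inj₁ w∈D  = Claimed-mono (closed paired (inj₁ w∈D))
    ... | inj₂ refl = inj₂ (subst (_∈ S ∪ ⁅ s ⁆) (sym (m-inv s)) (x∈p∪⁅x⁆ S s))
    closed′ (inj₂ w∈) with x∈p∪⁅y⁆⁻ S w∈
    ... | inj₁ w∈S  = Claimed-mono (closed paired (inj₂ w∈S))
    ... | inj₂ refl = inj₁ (x∈p∪⁅x⁆ D (m s))

  Paired⇒Dominating : ∀ {D S} → Paired D S → (∀ w → Claimed D S w) → Dominating G D
  Paired⇒Dominating paired all-claimed w with all-claimed w
  ... | inj₁ w∈D = inj₁ w∈D
  ... | inj₂ w∈S = inj₂ (m w , partner-of-staller paired w∈S , m-adj w)

  m≢id : ∀ v → m v ≢ v
  m≢id v mv≡v = irrefl G (subst (Adj G v) mv≡v (m-adj v))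

  pending-tail : ∀ {D S x L} → (∀ w → Claimed D S w ⊎ w ∈ₗ x ∷ L) → Claimed D S x →
                 ∀ w → Claimed D S w ⊎ w ∈ₗ L
  pending-tail pending x-claimed w with pending w
  ... | inj₁ w-claimed   = inj₁ w-claimed
  ... | inj₂ (here refl) = inj₁ x-claimed
  ... | inj₂ (there w∈L) = inj₂ w∈L

  -- The suc absorbs the parity of n: each round claims two new vertices.
  pairing : ∀ (L : List (Fin n)) k {D S} → Paired D S → (∀ w → Claimed D S w ⊎ w ∈ₗ L) →
            n ≤ suc (k * 2 + ∣ D ∪ S ∣) → ForcesIn G (ContainsDomSet G) k D S
  pairing [] k {D} paired pending _ =
    done (D , id , Paired⇒Dominating paired (λ w → [ id , (λ ()) ]′ (pending w)))
  pairing (x ∷ L) k {D} {S} paired pending bound with x ∈? D ∪ S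
  ... | yes x∈D∪S = pairing L k paired (pending-tail pending (x∈p∪q⁻ D S x∈D∪S)) bound
  ... | no x∉D∪S  = offer k bound
    where
    unclaimed : ∀ {y} → y ∉ D ∪ S → Unclaimed G D S y
    unclaimed y∉D∪S = y∉D∪S ∘ p⊆p∪q S , y∉D∪S ∘ q⊆p∪q D S

    mx∉D∪S : m x ∉ D ∪ S
    mx∉D∪S mx∈D∪S = x∉D∪S ([ p⊆p∪q S , q⊆p∪q D S ]′
                      (subst (Claimed D S) (m-inv x) (closed paired (x∈p∪q⁻ D S mx∈D∪S))))

    respond : ∀ k s → s ∉ D ∪ S → m s ∉ D ∪ S → x ≡ s ⊎ x ≡ m s → n ≤ suc (suc k * 2 + ∣ D ∪ S ∣) →
              ForcesIn G (ContainsDomSet G) k (D ∪ ⁅ m s ⁆) (S ∪ ⁅ s ⁆)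
    respond k s s∉D∪S ms∉D∪S x∈pair bound =
      pairing L k (Paired-step s paired) (pending-tail (Sum.map₁ Claimed-mono ∘ pending) x-claimed) bound′
      where
      x-claimed : Claimed (D ∪ ⁅ m s ⁆) (S ∪ ⁅ s ⁆) x
      x-claimed = [ (λ { refl → inj₂ (x∈p∪⁅x⁆ S s) }) , (λ { refl → inj₁ (x∈p∪⁅x⁆ D (m s)) }) ]′ x∈pair
      bound′ : n ≤ suc (k * 2 + ∣ (D ∪ ⁅ m s ⁆) ∪ (S ∪ ⁅ s ⁆) ∣)
      bound′ = ≤-trans bound (s≤s (≤-trans (≤-reflexive (sym (m+[2+n]≡2+[m+n] (k * 2) _)))
                                           (+-monoʳ-≤ (k * 2) (two-new⇒2+∣D∪S∣≤ s∉D∪S ms∉D∪S (m≢id s)))))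

    offer : ∀ k → n ≤ suc (k * 2 + ∣ D ∪ S ∣) → ForcesIn G (ContainsDomSet G) k D S
    offer zero bound = ⊥-elim (<-irrefl refl
      (≤-trans (two-new⇒2+∣D∪S∣≤ x∉D∪S mx∉D∪S (m≢id x)) (≤-trans (∣p∣≤n ((D ∪ ⁅ m x ⁆) ∪ (S ∪ ⁅ x ⁆))) bound)))
    offer (suc k) bound =
      move x (m x) (m≢id x ∘ sym) (unclaimed x∉D∪S) (unclaimed mx∉D∪S)
        (respond k x x∉D∪S mx∉D∪S (inj₁ refl) bound)
        (subst (λ y → ForcesIn G (ContainsDomSet G) k (D ∪ ⁅ y ⁆) (S ∪ ⁅ m x ⁆)) (m-inv x)
               (respond k (m x) mx∉D∪S (subst (_∉ D ∪ S) (sym (m-inv x)) x∉D∪S) (inj₂ (sym (m-inv x))) bound))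

perfectMatching⇒ForcesIn-half : ∀ {n} (G : Graph n) → HasPerfectMatching G →
                                ForcesIn G (ContainsDomSet G) (n / 2) ∅ ∅
perfectMatching⇒ForcesIn-half {n} G (m , m-adj , m-inv) =
  pairing (allFin n) (n / 2) Paired-∅ (λ w → inj₂ (∈-allFin w)) n≤1+[n/2]*2
  where
  open PairingStrategy G m m-adj m-inv
  open ≤-Reasoning
  n≤1+[n/2]*2 : n ≤ suc (n / 2 * 2 + ∣ ∅ {n} ∪ ∅ ∣)
  n≤1+[n/2]*2 = begin
    n                               ≡⟨ m≡m%n+[m/n]*n n 2 ⟩
    n % 2 + n / 2 * 2               ≤⟨ +-monoˡ-≤ (n / 2 * 2) (s≤s⁻¹ (m%n<n n 2)) ⟩
    suc (n / 2 * 2)                 ≤⟨ s≤s (m≤m+n (n / 2 * 2) _) ⟩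
    suc (n / 2 * 2 + ∣ ∅ {n} ∪ ∅ ∣) ∎

-- Leaves of forests

module _ {n : ℕ} (G : Graph n) where

  open import Data.List.Membership.DecPropositional (_≟_ {n}) using () renaming (_∈?_ to _∈ₗ?_)

  path-closes-cycle : ∀ {x y} pre {z post} → Unique (x ∷ y ∷ pre ++ z ∷ post) →
                      Linked (Adj G) (x ∷ y ∷ pre ++ z ∷ post) → Adj G x z → HasCycle G
  path-closes-cycle {x} {y} pre {z} unique path xz =
    x , y ∷ pre ++ [ z ] , s≤s (subst (1 ≤_) (sym (length-++ pre)) (m≤n+m 1 (length pre))) ,
    Unique-prefix (x ∷ y ∷ pre) unique , Linked-prefix-∷ʳ (x ∷ y ∷ pre) path (symAdj G xz)

  module _ (Alive : Fin n → Set) where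

    AliveNeighbourBesides : Fin n → Fin n → Set
    AliveNeighbourBesides x y = Σ (Fin n) λ z → Alive z × Adj G x z × z ≢ y

    -- Grow a path x ∷ y ∷ rest at x by an alive neighbour other than y: meeting
    -- the path again closes a cycle, and a Unique path has at most n vertices.
    acyclic⇒¬endless : ¬ HasCycle G → (∀ {x} → Alive x → ∀ y → ¬ ¬ AliveNeighbourBesides x y) →
                       ∀ {x} → ¬ Alive x
    acyclic⇒¬endless acyclic onwards {x} alive-x =
      onwards alive-x x λ (z , alive-z , xz , z≢x) →
        walk n (n≤1+n (suc n)) alive-z ((z≢x ∷ []) ∷ [] ∷ []) (symAdj G xz ∷ [-])
      where
      walk : ∀ k {x y rest} → n < length (x ∷ y ∷ rest) + k → Alive x →
             Unique (x ∷ y ∷ rest) → Linked (Adj G) (x ∷ y ∷ rest) → ⊥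
      walk zero bound _ unique _ = <⇒≱ (subst (n <_) (+-identityʳ _) bound) (Unique⇒length≤n unique)
      walk (suc k) {x} {y} {rest} bound alive-x unique path =
        onwards alive-x y λ (z , alive-z , xz , z≢y) → continue alive-z xz z≢y (z ∈ₗ? x ∷ y ∷ rest)
        where
        continue : ∀ {z} → Alive z → Adj G x z → z ≢ y → Dec (z ∈ₗ x ∷ y ∷ rest) → ⊥
        continue alive-z xz z≢y (no z∉path) =
          walk k (subst (n <_) (+-suc _ k) bound) alive-z (¬Any⇒All¬ _ z∉path ∷ unique) (symAdj G xz ∷ path)
        continue _ xz _   (yes (here refl))         = irrefl G xz
        continue _ _  z≢y (yes (there (here refl))) = z≢y refl
        continue _ xz _   (yes (there (there z∈rest))) with ∈-∃++ z∈rest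
        ... | pre , _ , refl = acyclic (path-closes-cycle pre unique path xz)

    IsolatedVertex : Set
    IsolatedVertex = Σ (Fin n) λ w → Alive w × (∀ z → Alive z → ¬ Adj G w z)

    LeafEdge : Set
    LeafEdge = Σ (Fin n) λ v → Σ (Fin n) λ u → Alive v × Alive u × Adj G v u × (∀ z → Alive z → Adj G v z → z ≡ u)

    acyclic⇒leaf-or-isolated : ¬ HasCycle G → ∀ {x} → Alive x → ¬ ¬ (IsolatedVertex ⊎ LeafEdge)
    acyclic⇒leaf-or-isolated acyclic alive-x neither = acyclic⇒¬endless acyclic onwards alive-x
      where
      onwards : ∀ {x} → Alive x → ∀ y → ¬ ¬ AliveNeighbourBesides x y
      onwards {x} alive-x y none = ¬¬-excluded-middle {A = Alive y × Adj G x y} λ where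
        (yes (alive-y , xy)) → neither (inj₂ (x , y , alive-x , alive-y , xy , λ z alive-z xz →
          decidable-stable (z ≟ y) (λ z≢y → none (z , alive-z , xz , z≢y))))
        (no ¬alive-y) → neither (inj₁ (x , alive-x , λ z alive-z xz →
          none (z , alive-z , xz , λ { refl → ¬alive-y (alive-z , xz) })))

  v≢u : ∀ {v u} → Adj G v u → v ≢ u
  v≢u vu refl = irrefl G vu

  ∈∉⇒≢ : ∀ {x y : Fin n} {R} → x ∈ₗ R → y ∉ₗ R → x ≢ y
  ∈∉⇒≢ x∈R y∉R refl = y∉R x∈R

  ∉-∷-∷ : ∀ {z v u : Fin n} {R} → z ≢ v → z ≢ u → z ∉ₗ R → z ∉ₗ v ∷ u ∷ R
  ∉-∷-∷ z≢v _   _   (here z≡v)          = z≢v z≡v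
  ∉-∷-∷ _   z≢u _   (there (here z≡u))  = z≢u z≡u
  ∉-∷-∷ _   _   z∉R (there (there z∈R)) = z∉R z∈R

  -- LeafDecomposition R U strips G − R, where R lists the removed vertices and
  -- U the removed supports: strip v u removes a v whose only remaining neighbour
  -- is u, until every vertex is removed or some w has only supports as neighbours.
  data LeafDecomposition (R U : List (Fin n)) : Set where
    covering : (∀ z → z ∈ₗ R) → LeafDecomposition R U
    isolated : ∀ w → w ∉ₗ R → (∀ z → Adj G w z → z ∈ₗ U) → LeafDecomposition R U
    strip    : ∀ v u → v ∉ₗ R → u ∉ₗ R → Adj G v u → (∀ z → Adj G v z → z ≡ u ⊎ z ∈ₗ U) →
               LeafDecomposition (v ∷ u ∷ R) (u ∷ U) → LeafDecomposition R U

  Boundary : List (Fin n) → List (Fin n) → Set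
  Boundary R U = ∀ {y z} → y ∉ₗ R → z ∈ₗ R → Adj G y z → z ∈ₗ U

  acyclic⇒¬¬LeafDecomposition : ¬ HasCycle G → ∀ k {R U} → n < length R + k → Unique R → Boundary R U →
                                 ¬ ¬ LeafDecomposition R U
  acyclic⇒¬¬LeafDecomposition acyclic zero bound unique _ _ =
    <⇒≱ (subst (n <_) (+-identityʳ _) bound) (Unique⇒length≤n unique)
  acyclic⇒¬¬LeafDecomposition acyclic (suc k) {R} {U} bound unique boundary ¬decomposition with all? (_∈ₗ? R)
  ... | yes covered = ¬decomposition (covering covered)
  ... | no ¬covered =
    acyclic⇒leaf-or-isolated (_∉ₗ R) acyclic (proj₂ (¬∀⟶∃¬ n _ (_∈ₗ? R) ¬covered)) [ stop , continue ]′
    where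
    removed : ∀ {z} → ¬ z ∉ₗ R → z ∈ₗ R
    removed {z} = decidable-stable (z ∈ₗ? R)

    stop : IsolatedVertex (_∉ₗ R) → ⊥
    stop (w , w∉R , lonely) =
      ¬decomposition (isolated w w∉R λ z wz → boundary w∉R (removed λ z∉R → lonely z z∉R wz) wz)

    continue : LeafEdge (_∉ₗ R) → ⊥
    continue (v , u , v∉R , u∉R , vu , only-u) =
      acyclic⇒¬¬LeafDecomposition acyclic k bound′ unique′ boundary′
        (¬decomposition ∘ strip v u v∉R u∉R vu neighbours)
      where
      neighbours : ∀ z → Adj G v z → z ≡ u ⊎ z ∈ₗ U
      neighbours z vz with z ∈ₗ? R
      ... | yes z∈R = inj₂ (boundary v∉R z∈R vz)
      ... | no z∉R  = inj₁ (only-u z z∉R vz)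
      bound′ : n < length (v ∷ u ∷ R) + k
      bound′ = ≤-trans bound (≤-trans (≤-reflexive (+-suc (length R) k)) (n≤1+n _))
      unique′ : Unique (v ∷ u ∷ R)
      unique′ = (v≢u vu ∷ ¬Any⇒All¬ _ v∉R) ∷ ¬Any⇒All¬ _ u∉R ∷ unique
      boundary′ : Boundary (v ∷ u ∷ R) (u ∷ U)
      boundary′ y∉ (here refl) yv = ⊥-elim (y∉ (there (here (only-u _ (y∉ ∘ there ∘ there) (symAdj G yv)))))
      boundary′ _  (there (here refl)) _ = here refl
      boundary′ y∉ (there (there z∈R)) yz = there (boundary (y∉ ∘ there ∘ there) z∈R yz)

  Covering : ∀ {R U} → LeafDecomposition R U → Set
  Covering (covering _)          = ⊤
  Covering (isolated _ _ _)      = ⊥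
  Covering (strip _ _ _ _ _ _ d) = Covering d

  leaves : ∀ {R U} → LeafDecomposition R U → List (Fin n)
  leaves (covering _)          = []
  leaves (isolated _ _ _)      = []
  leaves (strip v _ _ _ _ _ d) = v ∷ leaves d

  leaves-∉ : ∀ {R U} (d : LeafDecomposition R U) → All (_∉ₗ R) (leaves d)
  leaves-∉ (covering _)            = []
  leaves-∉ (isolated _ _ _)        = []
  leaves-∉ (strip _ _ v∉R _ _ _ d) = v∉R ∷ All.map (_∘ there ∘ there) (leaves-∉ d)

  leaves-unique : ∀ {R U} (d : LeafDecomposition R U) → Unique (leaves d)
  leaves-unique (covering _)          = []
  leaves-unique (isolated _ _ _)      = []
  leaves-unique (strip _ _ _ _ _ _ d) = All.map (λ z∉ v≡z → z∉ (here (sym v≡z))) (leaves-∉ d) ∷ leaves-unique d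

  covering⇒n≤ : ∀ {R U} (d : LeafDecomposition R U) → Covering d → n ≤ length R + length (leaves d) * 2
  covering⇒n≤ (covering complete) _ = ≤-trans (complete⇒n≤length complete) (m≤m+n _ _)
  covering⇒n≤ {R} (strip _ _ _ _ _ _ d) covers =
    subst (n ≤_) (sym (m+[2+n]≡2+[m+n] (length R) (length (leaves d) * 2))) (covering⇒n≤ d covers)

  pairUp : Fin n → Fin n → (Fin n → Fin n) → Fin n → Fin n
  pairUp v u f z with z ≟ v | z ≟ u
  ... | yes _ | _     = u
  ... | no _  | yes _ = v
  ... | no _  | no _  = f z

  pairUp-v : ∀ v u f → pairUp v u f v ≡ u
  pairUp-v v u f with v ≟ v
  ... | yes _  = refl
  ... | no v≢v = ⊥-elim (v≢v refl)

  pairUp-u : ∀ {v u} f → v ≢ u → pairUp v u f u ≡ v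
  pairUp-u {v} {u} f v≢u with u ≟ v | u ≟ u
  ... | yes u≡v | _      = ⊥-elim (v≢u (sym u≡v))
  ... | no _    | yes _  = refl
  ... | no _    | no u≢u = ⊥-elim (u≢u refl)

  pairUp-other : ∀ {v u} f {z} → z ≢ v → z ≢ u → pairUp v u f z ≡ f z
  pairUp-other {v} {u} f {z} z≢v z≢u with z ≟ v | z ≟ u
  ... | yes z≡v | _       = ⊥-elim (z≢v z≡v)
  ... | no _    | yes z≡u = ⊥-elim (z≢u z≡u)
  ... | no _    | no _    = refl

  partner : ∀ {R U} → LeafDecomposition R U → Fin n → Fin n
  partner (covering _)          = id
  partner (isolated _ _ _)      = id
  partner (strip v u _ _ _ _ d) = pairUp v u (partner d)

  partner-matches : ∀ {R U} (d : LeafDecomposition R U) → Covering d → ∀ {z} → z ∉ₗ R →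
                    Adj G z (partner d z) × partner d (partner d z) ≡ z × partner d z ∉ₗ R
  partner-matches (covering complete) _ z∉R = ⊥-elim (z∉R (complete _))
  partner-matches (strip v u v∉R u∉R vu _ d) covers {z} z∉R with z ≟ v | z ≟ u
  ... | yes refl | _    rewrite pairUp-u (partner d) (v≢u vu) = vu , refl , u∉R
  ... | no _ | yes refl rewrite pairUp-v v u (partner d)       = symAdj G vu , refl , v∉R
  ... | no z≢v | no z≢u with partner-matches d covers (∉-∷-∷ z≢v z≢u z∉R)
  ...   | z~p , p~z , p∉ rewrite pairUp-other (partner d) (p∉ ∘ here) (p∉ ∘ there ∘ here) =
    z~p , p~z , p∉ ∘ there ∘ there

  covering⇒perfectMatching : (d : LeafDecomposition [] []) → Covering d → HasPerfectMatching G
  covering⇒perfectMatching d covers =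
    partner d , (proj₁ ∘ matches) , (proj₁ ∘ proj₂ ∘ matches)
    where
    matches : ∀ z → Adj G z (partner d z) × partner d (partner d z) ≡ z × partner d z ∉ₗ []
    matches z = partner-matches d covers λ ()

  -- Staller's strategy on a leaf decomposition

  data Locate (v u : Fin n) : Fin n → Set where
    leaf    : Locate v u v
    support : Locate v u u
    outside : ∀ {x} → x ≢ v → x ≢ u → Locate v u x

  locate : ∀ v u x → Locate v u x
  locate v u x with x ≟ v | x ≟ u
  ... | yes refl | _        = leaf
  ... | no _     | yes refl = support
  ... | no x≢v   | no x≢u   = outside x≢v x≢u

  -- Dominator can dominate the leaf v of a Broken pair only through an earlier
  -- support, and she owns none of those while the earlier pairs are Intact.
  Intact : Fin n → Fin n → Subset n → Subset n → Set
  Intact v u D S = u ∉ D × (v ∈ D × u ∈ S ⊎ Unclaimed G D S v × u ∉ S)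

  Broken : Fin n → Fin n → Subset n → Subset n → Set
  Broken v u D S = v ∉ D × u ∉ D × (v ∈ S ⊎ u ∈ S)

  Safe : ∀ {R U} → LeafDecomposition R U → Subset n → Subset n → Set
  Safe (covering _)          D S = ⊤
  Safe (isolated w _ _)      D S = w ∉ D
  Safe (strip v u _ _ _ _ d) D S = Broken v u D S ⊎ Intact v u D S × Safe d D S

  Intact-away : ∀ {v u D S t g} → t ≢ v → t ≢ u → g ≢ v → g ≢ u →
                Intact v u D S → Intact v u (D ∪ ⁅ g ⁆) (S ∪ ⁅ t ⁆)
  Intact-away _ _ _ g≢u (u∉D , inj₁ (v∈D , u∈S)) = x∉p∪⁅y⁆ u∉D g≢u , inj₁ (p⊆p∪q _ v∈D , p⊆p∪q _ u∈S)
  Intact-away t≢v t≢u g≢v g≢u (u∉D , inj₂ ((v∉D , v∉S) , u∉S)) =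
    x∉p∪⁅y⁆ u∉D g≢u , inj₂ ((x∉p∪⁅y⁆ v∉D g≢v , x∉p∪⁅y⁆ v∉S t≢v) , x∉p∪⁅y⁆ u∉S t≢u)

  Intact-resolve : ∀ {v u D S} → v ≢ u → u ∉ D → Intact v u (D ∪ ⁅ v ⁆) (S ∪ ⁅ u ⁆)
  Intact-resolve {v} {u} {D} {S} v≢u u∉D = x∉p∪⁅y⁆ u∉D v≢u , inj₁ (x∈p∪⁅x⁆ D v , x∈p∪⁅x⁆ S u)

  Intact-break : ∀ {v u D S s g} → s ≡ v ⊎ s ≡ u → Unclaimed G D S s → g ≢ v → g ≢ u →
                 Intact v u D S → Broken v u (D ∪ ⁅ g ⁆) (S ∪ ⁅ s ⁆)
  Intact-break (inj₁ refl) (v∉D , _) _ _ (_ , inj₁ (v∈D , _)) = ⊥-elim (v∉D v∈D)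
  Intact-break (inj₂ refl) (_ , u∉S) _ _ (_ , inj₁ (_ , u∈S)) = ⊥-elim (u∉S u∈S)
  Intact-break {S = S} {s} s∈pair _ g≢v g≢u (u∉D , inj₂ ((v∉D , _) , _)) =
    x∉p∪⁅y⁆ v∉D g≢v , x∉p∪⁅y⁆ u∉D g≢u , Sum.map (λ { refl → x∈p∪⁅x⁆ S s }) (λ { refl → x∈p∪⁅x⁆ S s }) s∈pair

  Broken-away : ∀ {v u D S t g} → g ≢ v → g ≢ u → Broken v u D S → Broken v u (D ∪ ⁅ g ⁆) (S ∪ ⁅ t ⁆)
  Broken-away g≢v g≢u (v∉D , u∉D , taken) =
    x∉p∪⁅y⁆ v∉D g≢v , x∉p∪⁅y⁆ u∉D g≢u , Sum.map (p⊆p∪q _) (p⊆p∪q _) taken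

  Broken⇒¬unclaimed : ∀ {v u D S} → Broken v u D S → Unclaimed G D S v → ¬ Unclaimed G D S u
  Broken⇒¬unclaimed (_ , _ , inj₁ v∈S) (_ , v∉S) _ = v∉S v∈S
  Broken⇒¬unclaimed (_ , _ , inj₂ u∈S) _ (_ , u∉S) = u∉S u∈S

  Safe-∅ : ∀ {R U} (d : LeafDecomposition R U) → Safe d ∅ ∅
  Safe-∅ (covering _)          = _
  Safe-∅ (isolated _ _ _)      = ∉⊥
  Safe-∅ (strip _ _ _ _ _ _ d) = inj₂ ((∉⊥ , inj₂ ((∉⊥ , ∉⊥) , ∉⊥)) , Safe-∅ d)

  Safe-away : ∀ {R U} (d : LeafDecomposition R U) {D S t g} → t ∈ₗ R → g ∈ₗ R →
              Safe d D S → Safe d (D ∪ ⁅ g ⁆) (S ∪ ⁅ t ⁆)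
  Safe-away (covering _)       _   _   _   = _
  Safe-away (isolated _ w∉R _) _   g∈R w∉D = x∉p∪⁅y⁆ w∉D (∈∉⇒≢ g∈R w∉R)
  Safe-away (strip _ _ v∉R u∉R _ _ d) t∈R g∈R safe with safe
  ... | inj₁ broken          = inj₁ (Broken-away (∈∉⇒≢ g∈R v∉R) (∈∉⇒≢ g∈R u∉R) broken)
  ... | inj₂ (intact , rest) =
    inj₂ ( Intact-away (∈∉⇒≢ t∈R v∉R) (∈∉⇒≢ t∈R u∉R) (∈∉⇒≢ g∈R v∉R) (∈∉⇒≢ g∈R u∉R) intact
         , Safe-away d (there (there t∈R)) (there (there g∈R)) rest)

  Safe-reply : ∀ {R U} (d : LeafDecomposition R U) {D S a b} → a ≢ b → a ∉ₗ R → b ∉ₗ R →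
               Unclaimed G D S a → Unclaimed G D S b → Safe d D S →
               Safe d (D ∪ ⁅ b ⁆) (S ∪ ⁅ a ⁆) ⊎ Safe d (D ∪ ⁅ a ⁆) (S ∪ ⁅ b ⁆)
  Safe-reply (covering complete) _ a∉R _ _ _ _ = ⊥-elim (a∉R (complete _))
  Safe-reply (isolated w _ _) {a = a} a≢b _ _ _ _ w∉D with a ≟ w
  ... | yes refl = inj₁ (x∉p∪⁅y⁆ w∉D (a≢b ∘ sym))
  ... | no a≢w   = inj₂ (x∉p∪⁅y⁆ w∉D a≢w)
  Safe-reply (strip v u _ _ _ _ _) {a = a} {b} a≢b _ _ a-free b-free (inj₁ broken)
    with locate v u a | locate v u b
  ... | outside a≢v a≢u | _               = inj₂ (inj₁ (Broken-away a≢v a≢u broken))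
  ... | _               | outside b≢v b≢u = inj₁ (inj₁ (Broken-away b≢v b≢u broken))
  ... | leaf            | leaf            = ⊥-elim (a≢b refl)
  ... | support         | support         = ⊥-elim (a≢b refl)
  ... | leaf            | support         = ⊥-elim (Broken⇒¬unclaimed broken a-free b-free)
  ... | support         | leaf            = ⊥-elim (Broken⇒¬unclaimed broken b-free a-free)
  Safe-reply (strip v u _ _ vu _ d) {a = a} {b} a≢b a∉R b∉R a-free b-free (inj₂ (intact , safe))
    with locate v u a | locate v u b
  ... | outside a≢v a≢u | outside b≢v b≢u =
    Sum.map (λ safe′ → inj₂ (Intact-away a≢v a≢u b≢v b≢u intact , safe′))
            (λ safe′ → inj₂ (Intact-away b≢v b≢u a≢v a≢u intact , safe′))
            (Safe-reply d a≢b (∉-∷-∷ a≢v a≢u a∉R) (∉-∷-∷ b≢v b≢u b∉R) a-free b-free safe)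
  ... | leaf            | leaf            = ⊥-elim (a≢b refl)
  ... | support         | support         = ⊥-elim (a≢b refl)
  ... | leaf            | support         =
    inj₂ (inj₂ (Intact-resolve (v≢u vu) (proj₁ b-free) , Safe-away d (there (here refl)) (here refl) safe))
  ... | support         | leaf            =
    inj₁ (inj₂ (Intact-resolve (v≢u vu) (proj₁ a-free) , Safe-away d (there (here refl)) (here refl) safe))
  ... | leaf            | outside b≢v b≢u = inj₁ (inj₁ (Intact-break (inj₁ refl) a-free b≢v b≢u intact))
  ... | support         | outside b≢v b≢u = inj₁ (inj₁ (Intact-break (inj₂ refl) a-free b≢v b≢u intact))
  ... | outside a≢v a≢u | leaf            = inj₂ (inj₁ (Intact-break (inj₁ refl) b-free a≢v a≢u intact))
  ... | outside a≢v a≢u | support         = inj₂ (inj₁ (Intact-break (inj₂ refl) b-free a≢v a≢u intact))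

  neighbours∉ : ∀ {v u U D} → (∀ z → Adj G v z → z ≡ u ⊎ z ∈ₗ U) → u ∉ D → All (_∉ D) U →
                ∀ z → Adj G v z → z ∉ D
  neighbours∉ v-neighbours u∉D U∉D z vz = [ (λ { refl → u∉D }) , All.lookup U∉D ]′ (v-neighbours z vz)

  dominates-itself : ∀ {D X v} → X ⊆ D → Dominating G X → (∀ z → Adj G v z → z ∉ D) → v ∈ X
  dominates-itself {v = v} X⊆D dominating neighbours∉D with dominating v
  ... | inj₁ v∈X            = v∈X
  ... | inj₂ (z , z∈X , vz) = ⊥-elim (neighbours∉D z vz (X⊆D z∈X))

  Safe-dominated⇒Covering : ∀ {R U} (d : LeafDecomposition R U) {D S X} → All (_∉ D) U → Safe d D S →
                             X ⊆ D → Dominating G X → Covering d × All (_∈ X) (leaves d)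
  Safe-dominated⇒Covering (covering _) _ _ _ _ = _ , []
  Safe-dominated⇒Covering (isolated w _ w-neighbours) U∉D w∉D X⊆D dominating =
    ⊥-elim (w∉D (X⊆D (dominates-itself X⊆D dominating λ z wz → All.lookup U∉D (w-neighbours z wz))))
  Safe-dominated⇒Covering (strip v u _ _ _ v-neighbours d) U∉D safe X⊆D dominating with safe
  ... | inj₁ (v∉D , u∉D , _) =
    ⊥-elim (v∉D (X⊆D (dominates-itself X⊆D dominating (neighbours∉ v-neighbours u∉D U∉D))))
  ... | inj₂ ((u∉D , _) , rest) =
    Product.map₂ (dominates-itself X⊆D dominating (neighbours∉ v-neighbours u∉D U∉D) ∷_)
                 (Safe-dominated⇒Covering d (u∉D ∷ U∉D) rest X⊆D dominating)

module _ {n : ℕ} (G : Graph n) (acyclic : ¬ HasCycle G) where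

  Safe-excludes⇒¬Forces : ∀ {P} → (∀ (d : LeafDecomposition G [] []) {D S} → Safe G d D S → ¬ P D) →
                          ¬ Forces G P ∅ ∅
  Safe-excludes⇒¬Forces excludes forces =
    acyclic⇒¬¬LeafDecomposition G acyclic (suc n) ≤-refl [] (λ _ ()) λ d →
      maintained⇒¬Forces G (λ a b a≢b → Safe-reply G d a≢b (λ ()) (λ ())) (excludes d) (Safe-∅ G d) forces

  forest⇒¬Forces-size< : ∀ {j} → j < n / 2 → ¬ Forces G (ContainsDomSetOfSize≤ G j) ∅ ∅
  forest⇒¬Forces-size< {j} j<n/2 = Safe-excludes⇒¬Forces λ d safe (X , X⊆D , dominating , ∣X∣≤j) →
    let covers , leaves⊆X = Safe-dominated⇒Covering G d [] safe X⊆D dominating in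
    <⇒≱ j<n/2 (begin
      n / 2                ≤⟨ n≤m*2⇒n/2≤m (covering⇒n≤ G d covers) ⟩
      length (leaves G d)  ≤⟨ Unique⇒length≤∣p∣ (leaves-unique G d) leaves⊆X ⟩
      ∣ X ∣                ≤⟨ ∣X∣≤j ⟩
      j                    ∎)
    where open ≤-Reasoning

  ¬perfectMatching⇒¬DominatorWins : ¬ HasPerfectMatching G → ¬ DominatorWins G
  ¬perfectMatching⇒¬DominatorWins ¬matching = Safe-excludes⇒¬Forces λ d safe (X , X⊆D , dominating) →
    ¬matching (covering⇒perfectMatching G d (proj₁ (Safe-dominated⇒Covering G d [] safe X⊆D dominating)))

theorem1p7 : (n : ℕ) (T : Graph n) → IsTree T →
    (HasPerfectMatching T → γWC≡ T (n / 2) × sWC≡ T (n / 2)) ×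
    (¬ HasPerfectMatching T → ¬ DominatorWins T)
theorem1p7 n T (_ , acyclic) = withMatching , ¬perfectMatching⇒¬DominatorWins T acyclic
  where
  smaller-fails : ∀ j → j < n / 2 → ¬ Forces T (ContainsDomSetOfSize≤ T j) ∅ ∅
  smaller-fails j = forest⇒¬Forces-size< T acyclic

  withMatching : HasPerfectMatching T → γWC≡ T (n / 2) × sWC≡ T (n / 2)
  withMatching matching =
      (half-rounds , λ j j<n/2 → smaller-fails j j<n/2 ∘ ForcesIn-∅⇒Forces-size≤ T)
    , (ForcesIn-∅⇒Forces-size≤ T half-rounds , smaller-fails)
    where
    half-rounds : ForcesIn T (ContainsDomSet T) (n / 2) ∅ ∅
    half-rounds = perfectMatching⇒ForcesIn-half T matching
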